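{- Let $n,r$ be positive integers with $\gcd(r,n)=1$, let $K_r=2^{2r}-2^r+1$, and let $e$ be the least positive residue of the inverse of $r$ modulo $n$. Let $a\in\{1,\dots,2^n-2\}$ and let $(a_0,\dots,a_{n-1})\in\{0,1\}^n$ be given by $a_i=\alpha_{(-ir)\bmod n}$, where $a=\sum_{m=0}^{n-1}\alpha_m2^m$ is the binary expansion (so $a\equiv\sum_{i=0}^{n-1}a_i2^{ -ir}\pmod{2^n-1}$). The following are equivalent: (a) $a$ is the inverse of $K_r$ modulo $2^n-1$; (b) there exists a sequence $(c_0,\dots,c_{n-1})$ with $c_i\in\{ -1,0,1\}$ such that $$2c_0-c_e+1=a_2-a_1+a_0,\qquad 2c_i-c_{i+e}=a_{i+2}-a_{i+1}+a_i\ \text{ for all } i\in\mathbb{Z}_n,\ i\ne0,$$ where indices are taken modulo $n$. Moreover, the sequence $c$ in (b) is unique.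
   Context: Powers $2^{m}$ with arbitrary integer $m$ are understood modulo $2^n-1$, i.e. $2^m=2^{m\bmod n}$. -}

module Defs where

open import Data.Nat using (ℕ; zero; suc; _+_; _*_; _∸_; _^_; NonZero)
open import Data.Nat.DivMod using (_/_; _%_; m%n<n)
open import Data.Fin using (Fin; fromℕ<)
open import Data.Integer using (ℤ; +_)

-- K_r = 2^{2r} - 2^r + 1  (a natural number, since 2^{2r} ≥ 2^r)
K : ℕ → ℕ
K r = 2 ^ (2 * r) ∸ 2 ^ r + 1

bit : ℕ → ℕ → ℕ
bit a zero    = a % 2
bit a (suc m) = bit (a / 2) m

negMod : (n : ℕ) → .{{_ : NonZero n}} → ℕ → ℕ
negMod n k = (n ∸ k % n) % n

digit : (n r a : ℕ) → .{{_ : NonZero n}} → ℕ → ℤ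
digit n r a i = + bit a (negMod n (i * r))

idx : (n : ℕ) → .{{_ : NonZero n}} → ℕ → Fin n
idx n k = fromℕ< (m%n<n k n)

open import Data.Fin using (toℕ)
open import Data.Integer using (_-_; 0ℤ; 1ℤ; -1ℤ) renaming (_*_ to _*ℤ_; _+_ to _+ℤ_)
open import Data.Product using (_×_)
open import Data.Sum using (_⊎_)
open import Relation.Binary.PropositionalEquality using (_≡_; _≢_)

CondB : (n r e a : ℕ) → .{{_ : NonZero n}} → (Fin n → ℤ) → Set
CondB n r e a c =
    (∀ i → c i ≡ -1ℤ ⊎ c i ≡ 0ℤ ⊎ c i ≡ 1ℤ)
  × (∀ i → toℕ i ≡ 0
       → (+ 2) *ℤ c i - c (idx n (toℕ i + e)) +ℤ 1ℤ
         ≡ A 2 - A 1 +ℤ A 0)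
  × (∀ i → toℕ i ≢ 0
       → (+ 2) *ℤ c i - c (idx n (toℕ i + e))
         ≡ A (toℕ i + 2) - A (toℕ i + 1) +ℤ A (toℕ i))
  where
  A : ℕ → ℤ
  A = digit n r a

-- Put M = 2^n - 1 and D x = a_{x+2} - a_{x+1} + a_x - [x ≡ 0], so that (b) says 2 c_x - c_{x+e} = D x
-- for every x ∈ ℤ_n. As e is invertible modulo n, x ↦ x + e is a single cycle of length n, and
-- N x = Σ_{k<n} 2^{n-1-k} D (x + k e) satisfies 2 N x = M D x + N (x + e). Hence N - M c doubles along
-- the cycle and must vanish: a solution c is unique and equals N / M, and one exists iff M divides
-- every N x, iff M divides N 0, since 2 is invertible modulo M. The digit terms of N 0 are cyclic
-- rotations of the binary expansion of a, that is a · 2^j modulo M, and they add up to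
-- 2 N 0 ≡ a K_r - 1 (mod M). Finally c - 2 and -c - 2 at least double along the cycle, strictly at
-- some point, so going once around shows that both are negative: c_x ∈ {-1, 0, 1}.

module Submission where

open import Data.Nat as ℕ using (ℕ; NonZero)
open import Data.Nat.DivMod using (_%_)
open import Relation.Binary.PropositionalEquality using (_≡_)

module Arithmetic where
  open import Data.Nat as ℕ using (suc; _^_; _∸_)
  open import Data.Integer using (ℤ; +_; _+_; _-_; _*_; 1ℤ)
  import Data.Integer.Properties as ℤₚ
  open import Data.Integer.Tactic.RingSolver using (solve-∀; solve)
  open import Data.List using ([]; _∷_)
  open import Relation.Binary.PropositionalEquality

  pos-2^suc : ∀ m → + (2 ^ suc m) ≡ + 2 * + (2 ^ m)
  pos-2^suc m = ℤₚ.pos-* 2 (2 ^ m)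

  pos-∸ : ∀ {x y} → y ℕ.≤ x → + (x ∸ y) ≡ + x - + y
  pos-∸ {x} {y} y≤x = sym (trans (ℤₚ.m-n≡m⊖n x y) (ℤₚ.⊖-≥ y≤x))

  i≡j+k⇒k≡i-j : ∀ {i j k : ℤ} → i ≡ j + k → k ≡ i - j
  i≡j+k⇒k≡i-j {j = j} {k} refl = solve (j ∷ k ∷ [])

  i-j+j≡i : ∀ i j → i - j + j ≡ i
  i-j+j≡i = solve-∀

  i-[i-j]≡j : ∀ i j → i - (i - j) ≡ j
  i-[i-j]≡j = solve-∀

  i+1≡j⇒i≡j-1 : ∀ {i j} → i + 1ℤ ≡ j → i ≡ j - 1ℤ
  i+1≡j⇒i≡j-1 {i} refl = solve (i ∷ [])

  i≡j-1⇒i+1≡j : ∀ {i j} → i ≡ j - 1ℤ → i + 1ℤ ≡ j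
  i≡j-1⇒i+1≡j {j = j} refl = solve (j ∷ [])

module Horner where
  open import Data.Nat as ℕ using (zero; suc; _^_; _∸_; s≤s)
  import Data.Nat.Properties as ℕₚ
  open import Data.Nat.DivMod using (_%_; _/_; m%n<n; m≡m%n+[m/n]*n; m<n*o⇒m/o<n)
  open import Data.Sum using (_⊎_; inj₁; inj₂)
  open import Data.Integer using (ℤ; +_; _+_; _-_; _*_; 0ℤ; 1ℤ)
  import Data.Integer.Properties as ℤₚ
  open import Data.Integer.Tactic.RingSolver using (solve-∀)
  open import Function using (_∘_)
  open import Relation.Binary.PropositionalEquality
  open ≡-Reasoning
  open import Defs using (bit)
  open Arithmetic using (pos-2^suc)

  horner : (ℕ → ℤ) → ℕ → ℤ
  horner f zero    = 0ℤ
  horner f (suc m) = + 2 * horner f m + f m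

  horner-cong : ∀ {f g} m → (∀ k → k ℕ.< m → f k ≡ g k) → horner f m ≡ horner g m
  horner-cong zero    f≗g = refl
  horner-cong (suc m) f≗g =
    cong₂ (λ h x → + 2 * h + x) (horner-cong m (λ k k<m → f≗g k (ℕₚ.m<n⇒m<1+n k<m))) (f≗g m ℕₚ.≤-refl)

  horner-0 : ∀ m → horner (λ _ → 0ℤ) m ≡ 0ℤ
  horner-0 zero    = refl
  horner-0 (suc m) = cong (λ h → + 2 * h + 0ℤ) (horner-0 m)

  horner-plus : ∀ f g m → horner (λ k → f k + g k) m ≡ horner f m + horner g m
  horner-plus f g zero    = refl
  horner-plus f g (suc m) = begin
    + 2 * horner (λ k → f k + g k) m + (f m + g m)   ≡⟨ cong (λ h → + 2 * h + (f m + g m)) (horner-plus f g m) ⟩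
    + 2 * (horner f m + horner g m) + (f m + g m)     ≡⟨ regroup (horner f m) (horner g m) (f m) (g m) ⟩
    (+ 2 * horner f m + f m) + (+ 2 * horner g m + g m) ∎
    where
    regroup : ∀ u v x y → + 2 * (u + v) + (x + y) ≡ (+ 2 * u + x) + (+ 2 * v + y)
    regroup = solve-∀

  horner-minus : ∀ f g m → horner (λ k → f k - g k) m ≡ horner f m - horner g m
  horner-minus f g zero    = refl
  horner-minus f g (suc m) = begin
    + 2 * horner (λ k → f k - g k) m + (f m - g m)   ≡⟨ cong (λ h → + 2 * h + (f m - g m)) (horner-minus f g m) ⟩
    + 2 * (horner f m - horner g m) + (f m - g m)     ≡⟨ regroup (horner f m) (horner g m) (f m) (g m) ⟩
    (+ 2 * horner f m + f m) - (+ 2 * horner g m + g m) ∎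
    where
    regroup : ∀ u v x y → + 2 * (u - v) + (x - y) ≡ (+ 2 * u + x) - (+ 2 * v + y)
    regroup = solve-∀

  horner-leading : ∀ f m → horner f (suc m) ≡ f 0 * + (2 ^ m) + horner (f ∘ suc) m
  horner-leading f zero    = regroup (f 0)
    where
    regroup : ∀ x → + 2 * 0ℤ + x ≡ x * + 1 + 0ℤ
    regroup = solve-∀
  horner-leading f (suc m) = begin
    + 2 * horner f (suc m) + f (suc m)
      ≡⟨ cong (λ h → + 2 * h + f (suc m)) (horner-leading f m) ⟩
    + 2 * (f 0 * + (2 ^ m) + horner (f ∘ suc) m) + f (suc m)
      ≡⟨ regroup (f 0) (+ (2 ^ m)) (horner (f ∘ suc) m) (f (suc m)) ⟩
    f 0 * (+ 2 * + (2 ^ m)) + horner (f ∘ suc) (suc m)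
      ≡⟨ cong (λ p → f 0 * p + horner (f ∘ suc) (suc m)) (pos-2^suc m) ⟨
    f 0 * + (2 ^ suc m) + horner (f ∘ suc) (suc m) ∎
    where
    regroup : ∀ x p h y → + 2 * (x * p + h) + y ≡ x * (+ 2 * p) + (+ 2 * h + y)
    regroup = solve-∀

  horner-rotate : ∀ f m → f m ≡ f 0 → + 2 * horner f m ≡ (+ (2 ^ m) - 1ℤ) * f 0 + horner (f ∘ suc) m
  horner-rotate f m fm≡f0 = begin
    + 2 * horner f m                               ≡⟨ unshift (+ 2 * horner f m) (f m) ⟩
    horner f (suc m) - f m                         ≡⟨ cong₂ _-_ (horner-leading f m) fm≡f0 ⟩
    f 0 * + (2 ^ m) + horner (f ∘ suc) m - f 0     ≡⟨ regroup (f 0) (+ (2 ^ m)) (horner (f ∘ suc) m) ⟩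
    (+ (2 ^ m) - 1ℤ) * f 0 + horner (f ∘ suc) m    ∎
    where
    unshift : ∀ u x → u ≡ u + x - x
    unshift = solve-∀
    regroup : ∀ x p h → x * p + h - x ≡ (p - 1ℤ) * x + h
    regroup = solve-∀

  horner-bits : ∀ m a → a ℕ.< 2 ^ m → horner (λ k → + bit a (m ∸ suc k)) m ≡ + a
  horner-bits zero    zero    _       = refl
  horner-bits zero    (suc a) (s≤s ())
  horner-bits (suc m) a       a<2^1+m = begin
    + 2 * horner (λ k → + bit a (m ∸ k)) m + + bit a (m ∸ m)
      ≡⟨ cong₂ (λ h i → + 2 * h + + bit a i)
               (trans (horner-cong m higher) (horner-bits m (a / 2) a/2<2^m)) (ℕₚ.n∸n≡0 m) ⟩
    + 2 * + (a / 2) + + (a % 2)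
      ≡⟨ cong (_+ + (a % 2)) (ℤₚ.pos-* 2 (a / 2)) ⟨
    + (2 ℕ.* (a / 2)) + + (a % 2)
      ≡⟨ ℤₚ.pos-+ (2 ℕ.* (a / 2)) (a % 2) ⟨
    + (2 ℕ.* (a / 2) ℕ.+ a % 2)
      ≡⟨ cong +_ halves ⟩
    + a ∎
    where
    higher : ∀ k → k ℕ.< m → + bit a (m ∸ k) ≡ + bit (a / 2) (m ∸ suc k)
    higher k k<m = cong (λ i → + bit a i) (ℕₚ.+-∸-assoc 1 k<m)
    a/2<2^m : a / 2 ℕ.< 2 ^ m
    a/2<2^m = m<n*o⇒m/o<n (subst (a ℕ.<_) (ℕₚ.*-comm 2 (2 ^ m)) a<2^1+m)
    halves : 2 ℕ.* (a / 2) ℕ.+ a % 2 ≡ a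
    halves = begin
      2 ℕ.* (a / 2) ℕ.+ a % 2   ≡⟨ ℕₚ.+-comm (2 ℕ.* (a / 2)) (a % 2) ⟩
      a % 2 ℕ.+ 2 ℕ.* (a / 2)   ≡⟨ cong (a % 2 ℕ.+_) (ℕₚ.*-comm 2 (a / 2)) ⟩
      a % 2 ℕ.+ a / 2 ℕ.* 2     ≡⟨ m≡m%n+[m/n]*n a 2 ⟨
      a                         ∎

  bit-binary : ∀ a i → bit a i ≡ 0 ⊎ bit a i ≡ 1
  bit-binary a (suc i) = bit-binary (a / 2) i
  bit-binary a zero with a % 2 | m%n<n a 2
  ... | 0           | _               = inj₁ refl
  ... | 1           | _               = inj₂ refl
  ... | suc (suc _) | s≤s (s≤s ())

module Congruence (n : ℕ) .{{_ : NonZero n}} where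
  open import Data.Nat as ℕ using (suc; _∸_; z<s)
  import Data.Nat.Properties as ℕₚ
  open import Data.Nat.DivMod
    using (_%_; m%n<n; m%n%n≡m%n; n%n≡0; m<n⇒m%n≡m; %-distribˡ-+; %-distribˡ-*; [m+kn]%n≡m%n; [m+n]%n≡m%n)
  open import Data.Fin using (toℕ)
  import Data.Fin.Properties as Finₚ
  open import Data.Integer using (ℤ)
  open import Data.Sum using (inj₁; inj₂)
  open import Relation.Binary.PropositionalEquality
  open ≡-Reasoning
  open import Defs using (idx; negMod)

  infix 4 _≋_
  record _≋_ (x y : ℕ) : Set where
    constructor mk≋
    field %-≡ : x % n ≡ y % n
  open _≋_ public

  ≋-refl : ∀ {x} → x ≋ x
  ≋-refl = mk≋ refl

  ≋-sym : ∀ {x y} → x ≋ y → y ≋ x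
  ≋-sym (mk≋ eq) = mk≋ (sym eq)

  ≋-trans : ∀ {x y z} → x ≋ y → y ≋ z → x ≋ z
  ≋-trans (mk≋ eq) (mk≋ eq′) = mk≋ (trans eq eq′)

  ≋-reflexive : ∀ {x y} → x ≡ y → x ≋ y
  ≋-reflexive refl = ≋-refl

  ≋-+ : ∀ {x x′ y y′} → x ≋ x′ → y ≋ y′ → x ℕ.+ y ≋ x′ ℕ.+ y′
  ≋-+ {x} {x′} {y} {y′} (mk≋ x≋x′) (mk≋ y≋y′) = mk≋ (begin
    (x ℕ.+ y) % n            ≡⟨ %-distribˡ-+ x y n ⟩
    (x % n ℕ.+ y % n) % n    ≡⟨ cong₂ (λ u v → (u ℕ.+ v) % n) x≋x′ y≋y′ ⟩
    (x′ % n ℕ.+ y′ % n) % n  ≡⟨ %-distribˡ-+ x′ y′ n ⟨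
    (x′ ℕ.+ y′) % n          ∎)

  ≋-* : ∀ {x x′ y y′} → x ≋ x′ → y ≋ y′ → x ℕ.* y ≋ x′ ℕ.* y′
  ≋-* {x} {x′} {y} {y′} (mk≋ x≋x′) (mk≋ y≋y′) = mk≋ (begin
    (x ℕ.* y) % n              ≡⟨ %-distribˡ-* x y n ⟩
    (x % n ℕ.* (y % n)) % n    ≡⟨ cong₂ (λ u v → (u ℕ.* v) % n) x≋x′ y≋y′ ⟩
    (x′ % n ℕ.* (y′ % n)) % n  ≡⟨ %-distribˡ-* x′ y′ n ⟨
    (x′ ℕ.* y′) % n            ∎)

  %-≋ : ∀ x → x % n ≋ x
  %-≋ x = mk≋ (m%n%n≡m%n x n)

  ≋-+n : ∀ x → x ℕ.+ n ≋ x
  ≋-+n x = mk≋ ([m+n]%n≡m%n x n)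

  Periodic : (ℕ → ℤ) → Set
  Periodic h = ∀ {x y} → x ≋ y → h x ≡ h y

  periodic-return : ∀ {h} → Periodic h → ∀ e x → h (x ℕ.+ n ℕ.* e) ≡ h x
  periodic-return per e x = per (mk≋ (trans (cong (λ t → (x ℕ.+ t) % n) (ℕₚ.*-comm n e)) ([m+kn]%n≡m%n x e n)))

  toℕ-idx : ∀ x → toℕ (idx n x) ≡ x % n
  toℕ-idx x = Finₚ.toℕ-fromℕ< (m%n<n x n)

  idx-cong : ∀ {x y} → x ≋ y → idx n x ≡ idx n y
  idx-cong {x} {y} (mk≋ x≋y) = Finₚ.toℕ-injective (trans (toℕ-idx x) (trans x≋y (sym (toℕ-idx y))))

  idx-toℕ : ∀ i → idx n (toℕ i) ≡ i
  idx-toℕ i = Finₚ.toℕ-injective (trans (toℕ-idx (toℕ i)) (m<n⇒m%n≡m (Finₚ.toℕ<n i)))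

  ≋-toℕ-idx : ∀ x → x ≋ toℕ (idx n x)
  ≋-toℕ-idx x = ≋-sym (≋-trans (≋-reflexive (toℕ-idx x)) (%-≋ x))

  negMod-cong : ∀ {x y} → x ≋ y → negMod n x ≡ negMod n y
  negMod-cong (mk≋ x≋y) = cong (λ u → (n ∸ u) % n) x≋y

  negMod-suc : ∀ {k} → k ℕ.< n → negMod n (suc k) ≡ n ∸ suc k
  negMod-suc {k} k<n with ℕₚ.m≤n⇒m<n∨m≡n k<n
  ... | inj₁ 1+k<n = begin
    (n ∸ suc k % n) % n  ≡⟨ cong (λ u → (n ∸ u) % n) (m<n⇒m%n≡m 1+k<n) ⟩
    (n ∸ suc k) % n      ≡⟨ m<n⇒m%n≡m (ℕₚ.∸-monoʳ-< z<s (ℕₚ.<⇒≤ 1+k<n)) ⟩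
    n ∸ suc k            ∎
  ... | inj₂ refl = begin
    (n ∸ n % n) % n      ≡⟨ cong (λ u → (n ∸ u) % n) (n%n≡0 n) ⟩
    n % n                ≡⟨ n%n≡0 n ⟩
    0                    ≡⟨ ℕₚ.n∸n≡0 n ⟨
    n ∸ n                ∎

module Doubling (n : ℕ) .{{_ : NonZero n}} (e : ℕ) where
  open import Data.Nat as ℕ using (zero; suc; _^_; z<s)
  import Data.Nat.Properties as ℕₚ
  open import Data.Integer using (ℤ; +_; +0; +[1+_]; -[1+_]; -_; _+_; _*_; _≤_; _<_; 0ℤ; 1ℤ; -≤+; +<+)
  import Data.Integer.Properties as ℤₚ
  open import Data.Product using (∃-syntax; _,_)
  open import Data.Empty using (⊥-elim)
  open import Function using (_∘_)
  open import Relation.Nullary using (¬_)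
  open import Relation.Binary.PropositionalEquality
  open ℤₚ.≤-Reasoning

  ReturnsAfter-n : (ℕ → ℤ) → Set
  ReturnsAfter-n h = ∀ x → h (x ℕ.+ n ℕ.* e) ≡ h x

  iterate-≤ : ∀ {h} → (∀ x → + 2 * h x ≤ h (x ℕ.+ e)) → ∀ k x → + (2 ^ k) * h x ≤ h (x ℕ.+ k ℕ.* e)
  iterate-≤ {h} step zero    x = ℤₚ.≤-reflexive (trans (ℤₚ.*-identityˡ (h x)) (cong h (sym (ℕₚ.+-identityʳ x))))
  iterate-≤ {h} step (suc k) x = begin
    + (2 ^ suc k) * h x         ≡⟨ cong (_* h x) (ℤₚ.pos-* 2 (2 ^ k)) ⟩
    + 2 * + (2 ^ k) * h x       ≡⟨ ℤₚ.*-assoc (+ 2) (+ (2 ^ k)) (h x) ⟩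
    + 2 * (+ (2 ^ k) * h x)     ≤⟨ ℤₚ.*-monoˡ-≤-nonNeg (+ 2) (iterate-≤ step k x) ⟩
    + 2 * h (x ℕ.+ k ℕ.* e)     ≤⟨ step (x ℕ.+ k ℕ.* e) ⟩
    h (x ℕ.+ k ℕ.* e ℕ.+ e)     ≡⟨ cong h (ℕₚ.+-assoc x (k ℕ.* e) e) ⟩
    h (x ℕ.+ (k ℕ.* e ℕ.+ e))   ≡⟨ cong (λ t → h (x ℕ.+ t)) (ℕₚ.+-comm (k ℕ.* e) e) ⟩
    h (x ℕ.+ suc k ℕ.* e)       ∎

  scaled-≤⇒nonPos : ∀ {p v} → 2 ℕ.≤ p → + p * v ≤ v → v ≤ 0ℤ
  scaled-≤⇒nonPos {v = +0}       _   _    = ℤₚ.≤-refl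
  scaled-≤⇒nonPos {v = -[1+ _ ]} _   _    = -≤+
  scaled-≤⇒nonPos {p} {+[1+ m ]} 2≤p pv≤v =
    ⊥-elim (ℕₚ.<⇒≱ v<pv (ℤₚ.drop‿+≤+ (subst (_≤ +[1+ m ]) (sym (ℤₚ.pos-* p (suc m))) pv≤v)))
    where
    v<pv : suc m ℕ.< p ℕ.* suc m
    v<pv = subst (suc m ℕ.<_) (ℕₚ.*-comm (suc m) p) (ℕₚ.m<m*n (suc m) p 2≤p)

  nonPos : ∀ h → ReturnsAfter-n h → (∀ x → + 2 * h x ≤ h (x ℕ.+ e)) → ∀ x → h x ≤ 0ℤ
  nonPos h returns step x =
    scaled-≤⇒nonPos (ℕₚ.^-monoʳ-≤ 2 (ℕ.>-nonZero⁻¹ n)) (subst (+ (2 ^ n) * h x ≤_) (returns x) (iterate-≤ step n x))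

  negative : ∀ (h s : ℕ → ℤ) → ReturnsAfter-n h
           → (∀ x → h (x ℕ.+ e) ≡ + 2 * h x + s x) → (∀ x → 0ℤ ≤ s x) → (∀ x → ∃[ k ] 1ℤ ≤ s (x ℕ.+ k ℕ.* e))
           → ∀ x → h x < 0ℤ
  negative h s returns step s≥0 hit x = ℤₚ.≰⇒> 0≰hx
    where
    weak-step : ∀ x → + 2 * h x ≤ h (x ℕ.+ e)
    weak-step x = begin
      + 2 * h x          ≡⟨ ℤₚ.+-identityʳ (+ 2 * h x) ⟨
      + 2 * h x + 0ℤ     ≤⟨ ℤₚ.+-monoʳ-≤ (+ 2 * h x) (s≥0 x) ⟩
      + 2 * h x + s x    ≡⟨ step x ⟨
      h (x ℕ.+ e)        ∎
    0≰hx : ¬ 0ℤ ≤ h x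
    0≰hx 0≤hx with hit x
    ... | k , 1≤sy = ℤₚ.<⇒≱ (ℤₚ.≤-<-trans (nonPos h returns weak-step (y ℕ.+ e)) 0<h[y+e]) ℤₚ.≤-refl
      where
      y = x ℕ.+ k ℕ.* e
      0≤hy : 0ℤ ≤ h y
      0≤hy = begin
        0ℤ                ≡⟨ ℤₚ.*-zeroʳ (+ (2 ^ k)) ⟨
        + (2 ^ k) * 0ℤ    ≤⟨ ℤₚ.*-monoˡ-≤-nonNeg (+ (2 ^ k)) 0≤hx ⟩
        + (2 ^ k) * h x   ≤⟨ iterate-≤ weak-step k x ⟩
        h y               ∎
      0<h[y+e] : 0ℤ < h (y ℕ.+ e)
      0<h[y+e] = begin-strict
        0ℤ                ≡⟨ ℤₚ.*-zeroʳ (+ 2) ⟨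
        + 2 * 0ℤ          ≤⟨ ℤₚ.*-monoˡ-≤-nonNeg (+ 2) 0≤hy ⟩
        + 2 * h y         ≡⟨ ℤₚ.+-identityʳ (+ 2 * h y) ⟨
        + 2 * h y + 0ℤ    <⟨ ℤₚ.+-monoʳ-< (+ 2 * h y) (ℤₚ.<-≤-trans (+<+ z<s) 1≤sy) ⟩
        + 2 * h y + s y   ≡⟨ step y ⟨
        h (y ℕ.+ e)       ∎

  vanishes : ∀ h → ReturnsAfter-n h → (∀ x → h (x ℕ.+ e) ≡ + 2 * h x) → ∀ x → h x ≡ 0ℤ
  vanishes h returns step x = ℤₚ.≤-antisym (nonPos h returns (ℤₚ.≤-reflexive ∘ sym ∘ step) x) 0≤hx
    where
    -h-step : ∀ x → + 2 * - h x ≤ - h (x ℕ.+ e)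
    -h-step x = ℤₚ.≤-reflexive (trans (sym (ℤₚ.neg-distribʳ-* (+ 2) (h x))) (cong -_ (sym (step x))))
    0≤hx : 0ℤ ≤ h x
    0≤hx = subst (0ℤ ≤_) (ℤₚ.neg-involutive (h x))
             (ℤₚ.neg-mono-≤ (nonPos (-_ ∘ h) (cong -_ ∘ returns) -h-step x))

module InverseOfK (m r e a : ℕ)
                  (er≡1 : (e ℕ.* r) % (2 ℕ.+ m) ≡ 1 % (2 ℕ.+ m)) (a<2^n : a ℕ.< 2 ℕ.^ (2 ℕ.+ m)) where
  open import Data.Nat using (zero; suc; _^_; _∸_; z≤n; s≤s)
  import Data.Nat.Properties as ℕₚ
  open import Data.Nat.DivMod using (m%n≤n; n%n≡0; m<n⇒m%n≡m)
  open import Data.Integer as ℤ using (ℤ; +_; +0; +[1+_]; -[1+_]; -_; _+_; _-_; _*_; _≤_; _<_; 0ℤ; 1ℤ; -1ℤ; +<+)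
  import Data.Integer.Properties as ℤₚ
  open import Data.Integer.Tactic.RingSolver using (solve)
  open import Data.Integer.Divisibility.Signed
    using (_∣_; divides; quotient; ∣-refl; ∣m∣n⇒∣m+n; ∣m∣n⇒∣m-n; ∣n⇒∣m*n; ∣m⇒∣m*n; ∣ᵤ⇒∣; ∣⇒∣ᵤ)
  import Data.Integer.Divisibility as Unsigned
  open import Data.Fin as Fin using (Fin; toℕ)
  import Data.Fin.Properties as Finₚ
  open import Data.List using ([]; _∷_)
  open import Data.Product using (Σ-syntax; _×_; _,_; proj₁; proj₂)
  open import Data.Sum as Sum using (_⊎_; inj₁; inj₂)
  open import Data.Empty using (⊥-elim)
  open import Function using (_∘_)
  open import Function.Bundles using (_⇔_; mk⇔)
  open import Relation.Nullary using (¬_)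
  open import Relation.Nullary.Decidable using (True; toWitness)
  open import Relation.Binary.PropositionalEquality
  open ≡-Reasoning
  open import Defs

  n : ℕ
  n = 2 ℕ.+ m

  open Arithmetic
  open Horner
  open Congruence n
  open Doubling n e

  M : ℤ
  M = + (2 ^ n ∸ 1)

  2^n-1≡M : + (2 ^ n) - 1ℤ ≡ M
  2^n-1≡M = sym (pos-∸ (ℕₚ.m^n>0 2 n))

  2^n≡M+1 : + (2 ^ n) ≡ M + 1ℤ
  2^n≡M+1 = trans (cong +_ (sym (ℕₚ.m∸n+n≡m (ℕₚ.m^n>0 2 n)))) (ℤₚ.pos-+ (2 ^ n ∸ 1) 1)

  twice-2^[n∸1] : + 2 * + (2 ^ suc m) ≡ M + 1ℤ
  twice-2^[n∸1] = trans (sym (pos-2^suc (suc m))) 2^n≡M+1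

  M≢0 : M ≢ 0ℤ
  M≢0 M≡0 = ℕₚ.<⇒≢ (ℕₚ.^-monoʳ-≤ 2 {1} {n} (s≤s z≤n))
                    (sym (ℤₚ.+-injective (trans 2^n≡M+1 (cong (_+ 1ℤ) M≡0))))

  instance
    M-nonZero : ℤ.NonZero M
    M-nonZero = ℤ.≢-nonZero M≢0

  inverse-cancels : ∀ {u v} → u ℕ.* v ≋ 1 → ∀ x → x ℕ.* u ℕ.* v ≋ x
  inverse-cancels {u} {v} uv≋1 x =
    ≋-trans (≋-reflexive (ℕₚ.*-assoc x u v)) (≋-trans (≋-* (≋-refl {x}) uv≋1) (≋-reflexive (ℕₚ.*-identityʳ x)))

  e-then-r : ∀ k → k ℕ.* e ℕ.* r ≋ k
  e-then-r = inverse-cancels (mk≋ er≡1)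

  r-then-e : ∀ x → x ℕ.* r ℕ.* e ≋ x
  r-then-e = inverse-cancels (mk≋ (trans (cong (_% n) (ℕₚ.*-comm r e)) er≡1))

  A : ℕ → ℤ
  A = digit n r a

  isZero : ℕ → ℤ
  isZero zero    = 1ℤ
  isZero (suc _) = 0ℤ

  isZero-≢ : ∀ {i} → i ≢ 0 → isZero i ≡ 0ℤ
  isZero-≢ {zero}  i≢0 = ⊥-elim (i≢0 refl)
  isZero-≢ {suc _} _   = refl

  δ₀ : ℕ → ℤ
  δ₀ x = isZero (x % n)

  -- A (x + 0) rather than A x gives the three digit terms of D (k * e) the common shape along j k below.
  D : ℕ → ℤ
  D x = A (x ℕ.+ 2) - A (x ℕ.+ 1) + A (x ℕ.+ 0) - δ₀ x

  N : ℕ → ℤ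
  N x = horner (λ k → D (x ℕ.+ k ℕ.* e)) n

  -- the binary digits of a rotated cyclically, so that R p ≡ 2^(p-1) a (mod M)
  R : ℕ → ℤ
  R p = horner (λ k → + bit a (negMod n (k ℕ.+ p))) n

  A-periodic : Periodic A
  A-periodic x≋y = cong (λ i → + bit a i) (negMod-cong (≋-* x≋y ≋-refl))

  D-periodic : Periodic D
  D-periodic x≋y =
    cong₂ _-_ (cong₂ _+_ (cong₂ _-_ (A-periodic (≋-+ x≋y ≋-refl)) (A-periodic (≋-+ x≋y ≋-refl)))
                         (A-periodic (≋-+ x≋y ≋-refl)))
              (cong isZero (%-≡ x≋y))

  N-periodic : Periodic N
  N-periodic x≋y = horner-cong n (λ k _ → D-periodic (≋-+ x≋y ≋-refl))

  N-step : ∀ x → + 2 * N x ≡ M * D x + N (x ℕ.+ e)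
  N-step x = begin
    + 2 * N x                                      ≡⟨ horner-rotate f n f[n]≡f[0] ⟩
    (+ (2 ^ n) - 1ℤ) * f 0 + horner (f ∘ suc) n
      ≡⟨ cong₂ (λ u v → u * v + horner (f ∘ suc) n) 2^n-1≡M (cong D (ℕₚ.+-identityʳ x)) ⟩
    M * D x + horner (f ∘ suc) n
      ≡⟨ cong (λ t → M * D x + t) (horner-cong n (λ k _ → cong D (sym (ℕₚ.+-assoc x e (k ℕ.* e))))) ⟩
    M * D x + N (x ℕ.+ e)                          ∎
    where
    f : ℕ → ℤ
    f k = D (x ℕ.+ k ℕ.* e)
    f[n]≡f[0] : f n ≡ f 0
    f[n]≡f[0] = trans (periodic-return D-periodic e x) (cong D (sym (ℕₚ.+-identityʳ x)))

  R-step : ∀ p → + 2 * R p ≡ M * + bit a (negMod n p) + R (suc p)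
  R-step p = begin
    + 2 * R p                                      ≡⟨ horner-rotate g n g[n]≡g[0] ⟩
    (+ (2 ^ n) - 1ℤ) * g 0 + horner (g ∘ suc) n
      ≡⟨ cong₂ (λ u v → u * g 0 + v) 2^n-1≡M
               (horner-cong n (λ k _ → cong (λ i → + bit a (negMod n i)) (sym (ℕₚ.+-suc k p)))) ⟩
    M * + bit a (negMod n p) + R (suc p)           ∎
    where
    g : ℕ → ℤ
    g k = + bit a (negMod n (k ℕ.+ p))
    g[n]≡g[0] : g n ≡ g 0
    g[n]≡g[0] = cong (λ i → + bit a i) (negMod-cong (≋-trans (≋-reflexive (ℕₚ.+-comm n p)) (≋-+n p)))

  R-1 : R 1 ≡ + a
  R-1 = trans (horner-cong n (λ k k<n → cong (λ i → + bit a i) (trans (cong (negMod n) (ℕₚ.+-comm k 1)) (negMod-suc k<n))))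
              (horner-bits n a a<2^n)

  R-n : R n ≡ R 0
  R-n = horner-cong n (λ k _ → cong (λ i → + bit a i)
                                     (negMod-cong (≋-trans (≋-+n k) (≋-reflexive (sym (ℕₚ.+-identityʳ k))))))

  R-defect : ℕ → ℤ
  R-defect p = + 2 * R p - + (2 ^ p) * + a

  R-congruence-suc : ∀ p → M ∣ R-defect (suc p)
  R-congruence-suc zero    = divides 0ℤ (begin
    + 2 * R 1 - + 2 * + a    ≡⟨ cong (λ t → + 2 * t - + 2 * + a) R-1 ⟩
    + 2 * + a - + 2 * + a    ≡⟨ ℤₚ.+-inverseʳ (+ 2 * + a) ⟩
    0ℤ                       ≡⟨ ℤₚ.*-zeroˡ M ⟨
    0ℤ * M                   ∎)
  R-congruence-suc (suc p) =
    subst (M ∣_) (sym (trans (cong (λ q → + 2 * R (2 ℕ.+ p) - q * + a) (pos-2^suc (suc p)))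
                             (regroup (R (suc p)) (R (2 ℕ.+ p)) (+ (2 ^ suc p)) b M (+ a) (i≡j+k⇒k≡i-j (R-step (suc p))))))
          (∣m∣n⇒∣m-n (∣n⇒∣m*n (+ 2) (R-congruence-suc p)) (∣m⇒∣m*n (+ 2 * b) ∣-refl))
    where
    b : ℤ
    b = + bit a (negMod n (suc p))
    regroup : ∀ x y q b M a → y ≡ + 2 * x - M * b
            → + 2 * y - (+ 2 * q) * a ≡ + 2 * (+ 2 * x - q * a) - M * (+ 2 * b)
    regroup x .(+ 2 * x - M * b) q b M a refl = solve (x ∷ q ∷ b ∷ M ∷ a ∷ [])

  R-congruence : ∀ p → M ∣ R-defect p
  R-congruence (suc p) = R-congruence-suc p
  R-congruence zero    =
    subst (M ∣_) (sym (trans (cong (λ t → + 2 * t - + 1 * + a) (sym R-n)) (regroup (R n) (+ (2 ^ n)) M (+ a) 2^n≡M+1)))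
          (∣m∣n⇒∣m+n (R-congruence-suc (suc m)) (∣m⇒∣m*n (+ a) ∣-refl))
    where
    regroup : ∀ y q M a → q ≡ M + 1ℤ → + 2 * y - + 1 * a ≡ (+ 2 * y - q * a) + M * a
    regroup y .(M + 1ℤ) M a refl = solve (y ∷ M ∷ a ∷ [])

  orbit-meets-0-once : ∀ {k} → k ℕ.< n → k ℕ.* e ≋ 0 → k ≡ 0
  orbit-meets-0-once {k} k<n k*e≋0 = begin
    k                     ≡⟨ m<n⇒m%n≡m k<n ⟨
    k % n                 ≡⟨ %-≡ (≋-trans (≋-sym (e-then-r k)) (≋-* k*e≋0 (≋-refl {r}))) ⟩
    0                     ∎

  horner-δ₀ : horner (λ k → δ₀ (k ℕ.* e)) n ≡ + (2 ^ suc m)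
  horner-δ₀ = begin
    horner (λ k → δ₀ (k ℕ.* e)) n
      ≡⟨ horner-leading (λ k → δ₀ (k ℕ.* e)) (suc m) ⟩
    1ℤ * + (2 ^ suc m) + horner (λ k → δ₀ (suc k ℕ.* e)) (suc m)
      ≡⟨ cong (λ t → 1ℤ * + (2 ^ suc m) + t) (trans (horner-cong (suc m) off-0) (horner-0 (suc m))) ⟩
    1ℤ * + (2 ^ suc m) + 0ℤ
      ≡⟨ trans (ℤₚ.+-identityʳ _) (ℤₚ.*-identityˡ _) ⟩
    + (2 ^ suc m) ∎
    where
    off-0 : ∀ k → k ℕ.< suc m → δ₀ (suc k ℕ.* e) ≡ 0ℤ
    off-0 k k<1+m = isZero-≢ (λ 1+k≋0 → ℕₚ.1+n≢0 (orbit-meets-0-once (s≤s k<1+m) (mk≋ 1+k≋0)))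

  along : ℕ → ℕ → ℤ
  along j k = A (k ℕ.* e ℕ.+ j)

  horner-along : ∀ j → horner (along j) n ≡ R (j ℕ.* r)
  horner-along j = horner-cong n (λ k _ → cong (λ i → + bit a i) (negMod-cong (shifted k)))
    where
    shifted : ∀ k → (k ℕ.* e ℕ.+ j) ℕ.* r ≋ k ℕ.+ j ℕ.* r
    shifted k = ≋-trans (≋-reflexive (ℕₚ.*-distribʳ-+ r (k ℕ.* e) j)) (≋-+ (e-then-r k) ≋-refl)

  N0-split : N 0 ≡ R (2 ℕ.* r) - R r + R 0 - + (2 ^ suc m)
  N0-split = begin
    horner (λ k → along 2 k - along 1 k + along 0 k - z k) n
      ≡⟨ horner-minus (λ k → along 2 k - along 1 k + along 0 k) z n ⟩
    horner (λ k → along 2 k - along 1 k + along 0 k) n - horner z n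
      ≡⟨ cong (_- horner z n) (horner-plus (λ k → along 2 k - along 1 k) (along 0) n) ⟩
    horner (λ k → along 2 k - along 1 k) n + horner (along 0) n - horner z n
      ≡⟨ cong (λ t → t + horner (along 0) n - horner z n) (horner-minus (along 2) (along 1) n) ⟩
    horner (along 2) n - horner (along 1) n + horner (along 0) n - horner z n
      ≡⟨ cong₂ _-_ (cong₂ _+_ (cong₂ _-_ (horner-along 2) (trans (horner-along 1) (cong R (ℕₚ.*-identityˡ r))))
                              (horner-along 0))
                   horner-δ₀ ⟩
    R (2 ℕ.* r) - R r + R 0 - + (2 ^ suc m) ∎
    where
    z : ℕ → ℤ
    z k = δ₀ (k ℕ.* e)

  K-int : + K r ≡ + (2 ^ (2 ℕ.* r)) - + (2 ^ r) + 1ℤ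
  K-int = trans (ℤₚ.pos-+ (2 ^ (2 ℕ.* r) ∸ 2 ^ r) 1)
                (cong (_+ 1ℤ) (pos-∸ (ℕₚ.^-monoʳ-≤ 2 (ℕₚ.m≤m+n r (r ℕ.+ 0)))))

  N0-congruence : M ∣ + 2 * N 0 - (+ (a ℕ.* K r) - 1ℤ)
  N0-congruence = subst (M ∣_) (sym regrouped)
    (∣m∣n⇒∣m-n (∣m∣n⇒∣m+n (∣m∣n⇒∣m-n (R-congruence (2 ℕ.* r)) (R-congruence r)) (R-congruence 0)) ∣-refl)
    where
    regroup : ∀ y₂ y₁ y₀ z p₂ p₁ a {M} → M ≡ + 2 * z - 1ℤ
      → + 2 * (y₂ - y₁ + y₀ - z) - (a * (p₂ - p₁ + 1ℤ) - 1ℤ)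
        ≡ (+ 2 * y₂ - p₂ * a) - (+ 2 * y₁ - p₁ * a) + (+ 2 * y₀ - + 1 * a) - M
    regroup y₂ y₁ y₀ z p₂ p₁ a refl = solve (y₂ ∷ y₁ ∷ y₀ ∷ z ∷ p₂ ∷ p₁ ∷ a ∷ [])
    regrouped : + 2 * N 0 - (+ (a ℕ.* K r) - 1ℤ) ≡ R-defect (2 ℕ.* r) - R-defect r + R-defect 0 - M
    regrouped = begin
      + 2 * N 0 - (+ (a ℕ.* K r) - 1ℤ)
        ≡⟨ cong₂ (λ u v → + 2 * u - (v - 1ℤ)) N0-split (trans (ℤₚ.pos-* a (K r)) (cong (+ a *_) K-int)) ⟩
      + 2 * (R (2 ℕ.* r) - R r + R 0 - Z) - (+ a * (+ (2 ^ (2 ℕ.* r)) - + (2 ^ r) + 1ℤ) - 1ℤ)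
        ≡⟨ regroup (R (2 ℕ.* r)) (R r) (R 0) Z (+ (2 ^ (2 ℕ.* r))) (+ (2 ^ r)) (+ a) M≡2Z-1 ⟩
      R-defect (2 ℕ.* r) - R-defect r + R-defect 0 - M ∎
      where
      Z : ℤ
      Z = + (2 ^ suc m)
      M≡2Z-1 : M ≡ + 2 * Z - 1ℤ
      M≡2Z-1 = sym (trans (cong (_- 1ℤ) (sym (pos-2^suc (suc m)))) 2^n-1≡M)

  -- 2 is invertible modulo M, with inverse 2^(n-1)
  M∣2x⇒M∣x : ∀ {x} → M ∣ + 2 * x → M ∣ x
  M∣2x⇒M∣x {x} M∣2x = subst (M ∣_) (sym (regroup x (+ (2 ^ suc m)) M twice-2^[n∸1]))
    (∣m∣n⇒∣m-n (∣n⇒∣m*n (+ (2 ^ suc m)) M∣2x) (∣m⇒∣m*n x ∣-refl))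
    where
    regroup : ∀ x q M → + 2 * q ≡ M + 1ℤ → x ≡ q * (+ 2 * x) - M * x
    regroup x q M 2q≡M+1 = begin
      x                      ≡⟨ solve (x ∷ M ∷ []) ⟩
      (M + 1ℤ) * x - M * x   ≡⟨ cong (λ t → t * x - M * x) 2q≡M+1 ⟨
      (+ 2 * q) * x - M * x  ≡⟨ solve (x ∷ q ∷ M ∷ []) ⟩
      q * (+ 2 * x) - M * x  ∎

  ĉ : (Fin n → ℤ) → ℕ → ℤ
  ĉ c x = c (idx n x)

  ĉ-periodic : ∀ c → Periodic (ĉ c)
  ĉ-periodic c x≋y = cong c (idx-cong x≋y)

  Recurrence : (Fin n → ℤ) → Set
  Recurrence c = ∀ x → + 2 * ĉ c x - ĉ c (x ℕ.+ e) ≡ D x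

  recurrence⇒N≡M*ĉ : ∀ c → Recurrence c → ∀ x → N x ≡ M * ĉ c x
  recurrence⇒N≡M*ĉ c rec x =
    ℤₚ.i-j≡0⇒i≡j (N x) (M * ĉ c x) (vanishes f (periodic-return f-periodic e) f-doubles x)
    where
    f : ℕ → ℤ
    f x = N x - M * ĉ c x
    f-periodic : Periodic f
    f-periodic x≋y = cong₂ (λ u v → u - M * v) (N-periodic x≋y) (ĉ-periodic c x≋y)
    regroup : ∀ u u′ v v′ M → + 2 * u ≡ M * (+ 2 * v - v′) + u′ → u′ - M * v′ ≡ + 2 * (u - M * v)
    regroup u u′ v v′ M step = begin
      u′ - M * v′                                 ≡⟨ cong (λ t → t - M * v′) (i≡j+k⇒k≡i-j step) ⟩
      + 2 * u - M * (+ 2 * v - v′) - M * v′       ≡⟨ solve (u ∷ v ∷ v′ ∷ M ∷ []) ⟩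
      + 2 * (u - M * v)                           ∎
    f-doubles : ∀ x → f (x ℕ.+ e) ≡ + 2 * f x
    f-doubles x = regroup (N x) (N (x ℕ.+ e)) (ĉ c x) (ĉ c (x ℕ.+ e)) M
      (trans (N-step x) (cong (λ t → M * t + N (x ℕ.+ e)) (sym (rec x))))

  N≡M*ĉ⇒recurrence : ∀ c → (∀ x → N x ≡ M * ĉ c x) → Recurrence c
  N≡M*ĉ⇒recurrence c N≡M*ĉ x = ℤₚ.*-cancelˡ-≡ M _ _
    (regroup (ĉ c x) (ĉ c (x ℕ.+ e)) (D x) M (N≡M*ĉ x) (N≡M*ĉ (x ℕ.+ e)) (N-step x))
    where
    regroup : ∀ {u u′} v v′ d M → u ≡ M * v → u′ ≡ M * v′ → + 2 * u ≡ M * d + u′ → M * (+ 2 * v - v′) ≡ M * d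
    regroup v v′ d M refl refl step = begin
      M * (+ 2 * v - v′)        ≡⟨ solve (M ∷ v ∷ v′ ∷ []) ⟩
      + 2 * (M * v) - M * v′    ≡⟨ cong (_- M * v′) step ⟩
      M * d + M * v′ - M * v′   ≡⟨ solve (M ∷ d ∷ v′ ∷ []) ⟩
      M * d                     ∎

  M∣aK-1⇒M∣N : M ∣ + (a ℕ.* K r) - 1ℤ → ∀ x → M ∣ N x
  M∣aK-1⇒M∣N M∣aK-1 x = subst (M ∣_) (N-periodic (r-then-e x)) (M∣N[k*e] (x ℕ.* r))
    where
    M∣N0 : M ∣ N 0
    M∣N0 = M∣2x⇒M∣x (subst (M ∣_) (i-j+j≡i (+ 2 * N 0) (+ (a ℕ.* K r) - 1ℤ)) (∣m∣n⇒∣m+n N0-congruence M∣aK-1))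
    M∣N[k*e] : ∀ k → M ∣ N (k ℕ.* e)
    M∣N[k*e] zero    = M∣N0
    M∣N[k*e] (suc k) =
      subst (M ∣_) (trans (sym (i≡j+k⇒k≡i-j (N-step (k ℕ.* e)))) (cong N (ℕₚ.+-comm (k ℕ.* e) e)))
        (∣m∣n⇒∣m-n (∣n⇒∣m*n (+ 2) (M∣N[k*e] k)) (∣m⇒∣m*n (D (k ℕ.* e)) ∣-refl))

  M∣aK-1⇒recurrence : M ∣ + (a ℕ.* K r) - 1ℤ → Σ[ c ∈ (Fin n → ℤ) ] Recurrence c
  M∣aK-1⇒recurrence M∣aK-1 = c , N≡M*ĉ⇒recurrence c N≡M*ĉ
    where
    c : Fin n → ℤ
    c i = quotient (M∣aK-1⇒M∣N M∣aK-1 (toℕ i))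
    N≡M*ĉ : ∀ x → N x ≡ M * ĉ c x
    N≡M*ĉ x = begin
      N x                   ≡⟨ N-periodic (≋-toℕ-idx x) ⟩
      N (toℕ (idx n x))     ≡⟨ _∣_.equality (M∣aK-1⇒M∣N M∣aK-1 (toℕ (idx n x))) ⟩
      ĉ c x * M             ≡⟨ ℤₚ.*-comm (ĉ c x) M ⟩
      M * ĉ c x             ∎

  recurrence⇒M∣aK-1 : ∀ c → Recurrence c → M ∣ + (a ℕ.* K r) - 1ℤ
  recurrence⇒M∣aK-1 c rec = subst (M ∣_) (i-[i-j]≡j (+ 2 * N 0) (+ (a ℕ.* K r) - 1ℤ))
    (∣m∣n⇒∣m-n (∣n⇒∣m*n (+ 2) M∣N0) N0-congruence)
    where
    M∣N0 : M ∣ N 0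
    M∣N0 = divides (ĉ c 0) (trans (recurrence⇒N≡M*ĉ c rec 0) (ℤₚ.*-comm M (ĉ c 0)))

  recurrence-unique : ∀ c c′ → Recurrence c → Recurrence c′ → ∀ i → c i ≡ c′ i
  recurrence-unique c c′ rec rec′ i = begin
    c i                    ≡⟨ cong c (idx-toℕ i) ⟨
    ĉ c (toℕ i)            ≡⟨ ℤₚ.*-cancelˡ-≡ M _ _ M*ĉ≡M*ĉ′ ⟩
    ĉ c′ (toℕ i)           ≡⟨ cong c′ (idx-toℕ i) ⟩
    c′ i                   ∎
    where
    M*ĉ≡M*ĉ′ : M * ĉ c (toℕ i) ≡ M * ĉ c′ (toℕ i)
    M*ĉ≡M*ĉ′ = trans (sym (recurrence⇒N≡M*ĉ c rec (toℕ i))) (recurrence⇒N≡M*ĉ c′ rec′ (toℕ i))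

  Bit : ℤ → Set
  Bit v = v ≡ 0ℤ ⊎ v ≡ 1ℤ

  A-bit : ∀ x → Bit (A x)
  A-bit x = Sum.map (cong (+_)) (cong (+_)) (bit-binary a (negMod n (x ℕ.* r)))

  isZero-bit : ∀ i → Bit (isZero i)
  isZero-bit zero    = inj₂ refl
  isZero-bit (suc _) = inj₁ refl

  decide : ∀ {i j} {i≤j : True (i ℤₚ.≤? j)} → i ≤ j
  decide {i≤j = i≤j} = toWitness i≤j

  -- 2 - d and 2 + d are the amounts by which c - 2 and -c - 2 exceed doubling (see recurrence⇒ternary).
  Slack : ℤ → ℤ → Set
  Slack d z = (0ℤ ≤ + 2 - d) × (z ≡ 1ℤ → 1ℤ ≤ + 2 - d) × (0ℤ ≤ + 2 + d) × (z ≡ 0ℤ → 1ℤ ≤ + 2 + d)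

  slack : ∀ {u v w z} → Bit u → Bit v → Bit w → Bit z → Slack (u - v + w - z) z
  slack (inj₁ refl) (inj₁ refl) (inj₁ refl) (inj₁ refl) = decide , (λ ()) , decide , (λ _ → decide)
  slack (inj₁ refl) (inj₁ refl) (inj₂ refl) (inj₁ refl) = decide , (λ ()) , decide , (λ _ → decide)
  slack (inj₁ refl) (inj₂ refl) (inj₁ refl) (inj₁ refl) = decide , (λ ()) , decide , (λ _ → decide)
  slack (inj₁ refl) (inj₂ refl) (inj₂ refl) (inj₁ refl) = decide , (λ ()) , decide , (λ _ → decide)
  slack (inj₂ refl) (inj₁ refl) (inj₁ refl) (inj₁ refl) = decide , (λ ()) , decide , (λ _ → decide)
  slack (inj₂ refl) (inj₁ refl) (inj₂ refl) (inj₁ refl) = decide , (λ ()) , decide , (λ _ → decide)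
  slack (inj₂ refl) (inj₂ refl) (inj₁ refl) (inj₁ refl) = decide , (λ ()) , decide , (λ _ → decide)
  slack (inj₂ refl) (inj₂ refl) (inj₂ refl) (inj₁ refl) = decide , (λ ()) , decide , (λ _ → decide)
  slack (inj₁ refl) (inj₁ refl) (inj₁ refl) (inj₂ refl) = decide , (λ _ → decide) , decide , (λ ())
  slack (inj₁ refl) (inj₁ refl) (inj₂ refl) (inj₂ refl) = decide , (λ _ → decide) , decide , (λ ())
  slack (inj₁ refl) (inj₂ refl) (inj₁ refl) (inj₂ refl) = decide , (λ _ → decide) , decide , (λ ())
  slack (inj₁ refl) (inj₂ refl) (inj₂ refl) (inj₂ refl) = decide , (λ _ → decide) , decide , (λ ())
  slack (inj₂ refl) (inj₁ refl) (inj₁ refl) (inj₂ refl) = decide , (λ _ → decide) , decide , (λ ())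
  slack (inj₂ refl) (inj₁ refl) (inj₂ refl) (inj₂ refl) = decide , (λ _ → decide) , decide , (λ ())
  slack (inj₂ refl) (inj₂ refl) (inj₁ refl) (inj₂ refl) = decide , (λ _ → decide) , decide , (λ ())
  slack (inj₂ refl) (inj₂ refl) (inj₂ refl) (inj₂ refl) = decide , (λ _ → decide) , decide , (λ ())

  D-slack : ∀ x → Slack (D x) (δ₀ x)
  D-slack x = slack (A-bit (x ℕ.+ 2)) (A-bit (x ℕ.+ 1)) (A-bit (x ℕ.+ 0)) (isZero-bit (x % n))

  jump-to-0 : ℕ → ℕ
  jump-to-0 x = (n ∸ x % n) ℕ.* r

  jump-to-0-≋ : ∀ x → x ℕ.+ jump-to-0 x ℕ.* e ≋ 0
  jump-to-0-≋ x = mk≋ (begin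
    (x ℕ.+ t ℕ.* r ℕ.* e) % n    ≡⟨ %-≡ (≋-+ (≋-sym (%-≋ x)) (r-then-e t)) ⟩
    (x % n ℕ.+ t) % n            ≡⟨ cong (_% n) (ℕₚ.m+[n∸m]≡n (m%n≤n x n)) ⟩
    n % n                        ≡⟨ n%n≡0 n ⟩
    0                            ∎)
    where
    t = n ∸ x % n

  e≉0 : ¬ e ≋ 0
  e≉0 e≋0 = ℕₚ.1+n≢0 (trans (sym er≡1) (%-≡ (≋-* e≋0 (≋-refl {r}))))

  jump-past-0-≋ : ∀ x → x ℕ.+ suc (jump-to-0 x) ℕ.* e ≋ e
  jump-past-0-≋ x =
    ≋-trans (≋-reflexive reorder) (≋-trans (≋-+ (≋-refl {e}) (jump-to-0-≋ x)) (≋-reflexive (ℕₚ.+-identityʳ e)))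
    where
    y = jump-to-0 x ℕ.* e
    reorder : x ℕ.+ (e ℕ.+ y) ≡ e ℕ.+ (x ℕ.+ y)
    reorder = trans (sym (ℕₚ.+-assoc x e y)) (trans (cong (ℕ._+ y) (ℕₚ.+-comm x e)) (ℕₚ.+-assoc e x y))

  δ₀-jump-to-0 : ∀ x → δ₀ (x ℕ.+ jump-to-0 x ℕ.* e) ≡ 1ℤ
  δ₀-jump-to-0 x = cong isZero (%-≡ (jump-to-0-≋ x))

  δ₀-jump-past-0 : ∀ x → δ₀ (x ℕ.+ suc (jump-to-0 x) ℕ.* e) ≡ 0ℤ
  δ₀-jump-past-0 x = isZero-≢ (λ ≡0 → e≉0 (≋-trans (≋-sym (jump-past-0-≋ x)) (mk≋ ≡0)))

  Ternary : ℤ → Set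
  Ternary v = v ≡ -1ℤ ⊎ v ≡ 0ℤ ⊎ v ≡ 1ℤ

  ternary-of-bounds : ∀ {v} → v - + 2 < 0ℤ → - v - + 2 < 0ℤ → Ternary v
  ternary-of-bounds {+0}             _        _        = inj₂ (inj₁ refl)
  ternary-of-bounds {+[1+ 0 ]}       _        _        = inj₂ (inj₂ refl)
  ternary-of-bounds {+[1+ suc _ ]}   (+<+ ()) _
  ternary-of-bounds { -[1+ 0 ]}      _        _        = inj₁ refl
  ternary-of-bounds { -[1+ suc _ ]}  _        (+<+ ())

  recurrence⇒ternary : ∀ c → Recurrence c → ∀ x → Ternary (ĉ c x)
  recurrence⇒ternary c rec x = ternary-of-bounds (c-2<0 x) (-c-2<0 x)
    where
    upper : ∀ v v′ {d} → + 2 * v - v′ ≡ d → v′ - + 2 ≡ + 2 * (v - + 2) + (+ 2 - d)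
    upper v v′ refl = solve (v ∷ v′ ∷ [])
    lower : ∀ v v′ {d} → + 2 * v - v′ ≡ d → - v′ - + 2 ≡ + 2 * (- v - + 2) + (+ 2 + d)
    lower v v′ refl = solve (v ∷ v′ ∷ [])
    c-2<0 : ∀ x → ĉ c x - + 2 < 0ℤ
    c-2<0 = negative (λ y → ĉ c y - + 2) (λ y → + 2 - D y)
      (periodic-return (cong (_- + 2) ∘ ĉ-periodic c) e)
      (λ y → upper (ĉ c y) (ĉ c (y ℕ.+ e)) (rec y))
      (proj₁ ∘ D-slack)
      (λ y → jump-to-0 y , proj₁ (proj₂ (D-slack (y ℕ.+ jump-to-0 y ℕ.* e))) (δ₀-jump-to-0 y))
    -c-2<0 : ∀ x → - ĉ c x - + 2 < 0ℤ
    -c-2<0 = negative (λ y → - ĉ c y - + 2) (λ y → + 2 + D y)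
      (periodic-return (cong (λ v → - v - + 2) ∘ ĉ-periodic c) e)
      (λ y → lower (ĉ c y) (ĉ c (y ℕ.+ e)) (rec y))
      (proj₁ ∘ proj₂ ∘ proj₂ ∘ D-slack)
      (λ y → suc (jump-to-0 y)
           , proj₂ (proj₂ (proj₂ (D-slack (y ℕ.+ suc (jump-to-0 y) ℕ.* e)))) (δ₀-jump-past-0 y))

  D-off-0 : ∀ (j : Fin (suc m)) → let x = toℕ (Fin.suc j) in D x ≡ A (x ℕ.+ 2) - A (x ℕ.+ 1) + A x
  D-off-0 j = begin
    A (x ℕ.+ 2) - A (x ℕ.+ 1) + A (x ℕ.+ 0) - δ₀ x
      ≡⟨ cong₂ (λ u v → A (x ℕ.+ 2) - A (x ℕ.+ 1) + A u - v) (ℕₚ.+-identityʳ x) (isZero-≢ x%n≢0) ⟩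
    A (x ℕ.+ 2) - A (x ℕ.+ 1) + A x - 0ℤ            ≡⟨ ℤₚ.+-identityʳ _ ⟩
    A (x ℕ.+ 2) - A (x ℕ.+ 1) + A x                 ∎
    where
    x = toℕ (Fin.suc j)
    x%n≢0 : x % n ≢ 0
    x%n≢0 x%n≡0 = ℕₚ.1+n≢0 (trans (sym (m<n⇒m%n≡m (Finₚ.toℕ<n (Fin.suc j)))) x%n≡0)

  Steps : (Fin n → ℤ) → Set
  Steps c = ∀ i → + 2 * c i - c (idx n (toℕ i ℕ.+ e)) ≡ D (toℕ i)

  steps⇒recurrence : ∀ c → Steps c → Recurrence c
  steps⇒recurrence c steps x = begin
    + 2 * ĉ c x - ĉ c (x ℕ.+ e)
      ≡⟨ cong (λ j → + 2 * ĉ c x - c j) (idx-cong (≋-+ (≋-toℕ-idx x) (≋-refl {e}))) ⟩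
    + 2 * c i - c (idx n (toℕ i ℕ.+ e))  ≡⟨ steps i ⟩
    D (toℕ i)                            ≡⟨ D-periodic (≋-toℕ-idx x) ⟨
    D x                                  ∎
    where
    i = idx n x

  recurrence⇒steps : ∀ c → Recurrence c → Steps c
  recurrence⇒steps c rec i =
    subst (λ j → + 2 * c j - c (idx n (toℕ i ℕ.+ e)) ≡ D (toℕ i)) (idx-toℕ i) (rec (toℕ i))

  condB⇒recurrence : ∀ c → CondB n r e a c → Recurrence c
  condB⇒recurrence c (_ , at-0 , off-0) = steps⇒recurrence c steps
    where
    steps : Steps c
    steps Fin.zero    = i+1≡j⇒i≡j-1 (at-0 Fin.zero refl)
    steps (Fin.suc j) = trans (off-0 (Fin.suc j) (λ ())) (sym (D-off-0 j))

  recurrence⇒condB : ∀ c → Recurrence c → CondB n r e a c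
  recurrence⇒condB c rec =
      (λ i → subst Ternary (cong c (idx-toℕ i)) (recurrence⇒ternary c rec (toℕ i)))
    , (λ { Fin.zero _ → i≡j-1⇒i+1≡j (steps Fin.zero) ; (Fin.suc _) () })
    , (λ { Fin.zero 0≢0 → ⊥-elim (0≢0 refl) ; (Fin.suc j) _ → trans (steps (Fin.suc j)) (D-off-0 j) })
    where
    steps : Steps c
    steps = recurrence⇒steps c rec

  characterisation : (+ (2 ^ n ∸ 1) Unsigned.∣ + (a ℕ.* K r) - 1ℤ ⇔ (Σ[ c ∈ (Fin n → ℤ) ] CondB n r e a c))
          × ((c c′ : Fin n → ℤ) → CondB n r e a c → CondB n r e a c′ → ∀ i → c i ≡ c′ i)
  characterisation =
      mk⇔ (λ M∣aK-1 → let c , rec = M∣aK-1⇒recurrence (∣ᵤ⇒∣ M∣aK-1) in c , recurrence⇒condB c rec)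
          (λ (c , condB) → ∣⇒∣ᵤ (recurrence⇒M∣aK-1 c (condB⇒recurrence c condB)))
    , λ c c′ condB condB′ → recurrence-unique c c′ (condB⇒recurrence c condB) (condB⇒recurrence c′ condB′)

open import Defs
open import Data.Nat using (ℕ; _*_; _∸_; _^_; _≤_; NonZero)
open import Data.Nat.DivMod using (_%_)
open import Data.Nat.GCD using (gcd)
open import Data.Fin using (Fin)
open import Data.Integer using (ℤ; +_; _-_; 1ℤ)
open import Data.Integer.Divisibility using (_∣_)
open import Data.Product using (_×_; Σ-syntax)
open import Function.Bundles using (_⇔_)
open import Relation.Binary.PropositionalEquality using (_≡_)
open import Data.Nat using (zero; suc; _<_; z≤n; s≤s; z<s)
import Data.Nat.Properties as ℕₚ
open import Data.Empty using (⊥-elim)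

-- For n ≤ 1 no a is admissible; otherwise only e r ≡ 1 (mod n) and a < 2^n are used.
theorem6 : (n r : ℕ) → .{{_ : NonZero n}} → 1 ≤ r → gcd r n ≡ 1
    → (e : ℕ) → 1 ≤ e → e ≤ n → (e * r) % n ≡ 1 % n
    → (a : ℕ) → 1 ≤ a → a ≤ 2 ^ n ∸ 2
    → ((+ (2 ^ n ∸ 1)) ∣ (+ (a * K r) - 1ℤ)
         ⇔ (Σ[ c ∈ (Fin n → ℤ) ] CondB n r e a c))
      × ((c c′ : Fin n → ℤ) → CondB n r e a c → CondB n r e a c′ → ∀ i → c i ≡ c′ i)
theorem6 zero          r _ _ e _ _ _    a 1≤a a≤0 = ⊥-elim (ℕₚ.<⇒≱ 1≤a a≤0)
theorem6 (suc zero)    r _ _ e _ _ _    a 1≤a a≤0 = ⊥-elim (ℕₚ.<⇒≱ 1≤a a≤0)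
theorem6 (suc (suc m)) r _ _ e _ _ er≡1 a _   a≤2^n-2 =
  InverseOfK.characterisation m r e a er≡1 (ℕₚ.≤-<-trans a≤2^n-2 2^n-2<2^n)
  where
  2^n-2<2^n : 2 ^ suc (suc m) ∸ 2 < 2 ^ suc (suc m)
  2^n-2<2^n = ℕₚ.∸-monoʳ-< {o = 0} z<s (ℕₚ.^-monoʳ-≤ 2 {1} {suc (suc m)} (s≤s z≤n))
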